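{- Let $\mathcal P$ be a set of formulas. If $\Gamma\vdash_{\mathcal P}\Delta;\Pi$, then the two-sided linear logic sequent $t(\Gamma)\vdash ?t(\Delta),t(\Pi)$ is derivable in $\mathrm{LL}$, where for a multiset $\Gamma=A_1,\dots,A_n$ one writes $t(\Gamma)=t(A_1),\dots,t(A_n)$ and $?t(\Delta)$ denotes $?t(D_1),\dots,?t(D_m)$ for $\Delta=D_1,\dots,D_m$.
   Context: Formulas are given by the grammar $F ::= 0 \mid \perp \mid X \mid F\wedge F \mid F\vee F \mid F\rightarrow F$, where $X$ ranges over a set $\mathcal V$ of propositional variables and $0$, $\perp$ are two distinct constants. $\mathrm{LL}$ is (propositional, two-sided) Girard linear logic, with the elements of $\mathcal V$ used as atoms. The translations $b,t$ from formulas to LL formulas are defined by mutual recursion: $b(A)=t(A)$ if $A\notin\mathcal P$ and $b(A)=?t(A)$ if $A\in\mathcal P$; $t(0)=t(\perp)=0$ (the additive zero of LL); $t(X)=!X$ for $X\in\mathcal V$; $t(A\wedge B)=!b(A)\otimes !b(B)$; $t(A\vee B)=!b(A)\oplus !b(B)$; $t(A\rightarrow B)=!(t(A)\multimap b(B))$. Fix a set $\mathcal P$ of formulas. A $\mathcal P$-sequent is an expression $\Gamma\vdash\Delta;\Pi$ where $\Gamma,\Delta,\Pi$ are finite multisets of formulas, every formula of $\Delta$ (the body) belongs to $\mathcal P$, and $\Pi$ (the stoup) contains at most one formula. The system $\mathrm{ML}_{\mathcal P}$ derives $\mathcal P$-sequents with the following rules (below $C$ denotes a single formula, $\Pi$ a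 stoup with at most one formula, and all sequents must be $\mathcal P$-sequents): Axiom/cuts: $ax$: $A\vdash ;A$. $cut_1$: from $\Gamma\vdash\Delta;A$ and $\Gamma',A\vdash\Delta';\Pi$ infer $\Gamma,\Gamma'\vdash\Delta,\Delta';\Pi$. $cut_2$: from $\Gamma\vdash\Delta,A;\Pi$ and $\Gamma',A\vdash\Delta';$ infer $\Gamma,\Gamma'\vdash\Delta,\Delta';\Pi$. Structure: $der$: from $\Gamma\vdash\Delta;A$ with $A\in\mathcal P$ infer $\Gamma\vdash\Delta,A;$. $c_l$: from $\Gamma,A,A\vdash\Delta;\Pi$ infer $\Gamma,A\vdash\Delta;\Pi$. $c_r$: from $\Gamma\vdash\Delta,A,A;\Pi$ infer $\Gamma\vdash\Delta,A;\Pi$. $w_l$: from $\Gamma\vdash\Delta;\Pi$ infer $\Gamma,A\vdash\Delta;\Pi$. $w_r$: from $\Gamma\vdash\Delta;\Pi$ with $A\in\mathcal P$ infer $\Gamma\vdash\Delta,A;\Pi$. Logic: $0$: $\Gamma,0\vdash\Delta;\Pi$ (any $\Delta\subseteq\mathcal P$). $\perp$: $\perp\vdash ;$. $\wedge^1_l$: from $\Gamma,A,B\vdash\Delta;C$ with $A\notin\mathcal P$ and $B\notin\mathcal P$ infer $\Gamma,A\wedge B\vdash\Delta;C$. $\wedge^2_l$: from $\Gamma,A,B\vdash\Delta;$ infer $\Gamma,A\wedge B\vdash\Delta;$. $\wedge^1_r$: from $\Gamma\vdash\Delta;A$ and $\Gamma'\vdash\Delta';B$ infer $\Gamma,\Gamma'\vdash\Delta,\Delta';A\wedge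 B$. $\wedge^2_r$: from $\Gamma\vdash\Delta,A;$ and $\Gamma'\vdash\Delta',B;$ infer the same conclusion. $\wedge^3_r$: from $\Gamma\vdash\Delta;A$ and $\Gamma'\vdash\Delta',B;$ infer the same conclusion. $\wedge^4_r$: from $\Gamma\vdash\Delta,A;$ and $\Gamma'\vdash\Delta';B$ infer the same conclusion. $\vee^1_l$: from $\Gamma,A\vdash\Delta;C$ and $\Gamma,B\vdash\Delta;C$ with $A\notin\mathcal P$ and $B\notin\mathcal P$ infer $\Gamma,A\vee B\vdash\Delta;C$. $\vee^2_l$: from $\Gamma,A\vdash\Delta;$ and $\Gamma,B\vdash\Delta;$ infer $\Gamma,A\vee B\vdash\Delta;$. $\vee^1_r$: from $\Gamma\vdash\Delta;A$ infer $\Gamma\vdash\Delta;A\vee B$. $\vee^2_r$: from $\Gamma\vdash\Delta;B$ infer $\Gamma\vdash\Delta;A\vee B$. $\vee^3_r$: from $\Gamma\vdash\Delta,A;$ infer $\Gamma\vdash\Delta;A\vee B$. $\vee^4_r$: from $\Gamma\vdash\Delta,B;$ infer $\Gamma\vdash\Delta;A\vee B$. $\rightarrow^1_l$: from $\Gamma,B\vdash\Delta;C$ and $\Gamma'\vdash\Delta';A$ with $B\notin\mathcal P$ infer $\Gamma,\Gamma',A\rightarrow B\vdash\Delta,\Delta';C$. $\rightarrow^2_l$: from $\Gamma,B\vdash\Delta;$ and $\Gamma'\vdash\Delta';A$ infer $\Gamma,\Gamma',A\rightarrow B\vdash\Delta,\Delta';$. $\rightarrow^3_l$: from $\Gamma,B\vdash\Delta;$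 and $\Gamma'\vdash\Delta',A;\Pi$ infer $\Gamma,\Gamma',A\rightarrow B\vdash\Delta,\Delta';\Pi$. $\rightarrow^1_r$: from $\Gamma,A\vdash\Delta;B$ infer $\Gamma\vdash\Delta;A\rightarrow B$. $\rightarrow^2_r$: from $\Gamma,A\vdash\Delta,B;$ infer $\Gamma\vdash\Delta;A\rightarrow B$. One writes $\Gamma\vdash_{\mathcal P}\Delta;\Pi$ when the $\mathcal P$-sequent $\Gamma\vdash\Delta;\Pi$ is derivable in $\mathrm{ML}_{\mathcal P}$. -}

module Defs where

open import Data.Bool using (Bool; true; false; if_then_else_)
open import Data.List using (List; []; _∷_; _++_; map)
open import Data.List.Relation.Unary.All using (All)
open import Data.List.Relation.Binary.Permutation.Propositional using (_↭_)
open import Data.Maybe using (Maybe; just; nothing)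
open import Relation.Binary.PropositionalEquality using (_≡_)

infixr 8 _∧ᶠ_
infixr 7 _∨ᶠ_
infixr 6 _⇒ᶠ_

data Formula (V : Set) : Set where
  zeroᶠ : Formula V
  botᶠ  : Formula V
  var   : V → Formula V
  _∧ᶠ_  : Formula V → Formula V → Formula V
  _∨ᶠ_  : Formula V → Formula V → Formula V
  _⇒ᶠ_  : Formula V → Formula V → Formula V

infixr 8 _⊗_ _&_
infixr 7 _⅋_ _⊕_
infixr 6 _⊸_
infix 9 _ᗮ
infix 10 !_ ¿_

data LFormula (V : Set) : Set where
  atom : V → LFormula V
  𝟏 : LFormula V
  ⊥ₗ : LFormula V
  ⊤ₗ : LFormula V
  𝟎 : LFormula V
  _⊗_ : LFormula V → LFormula V → LFormula V
  _⅋_ : LFormula V → LFormula V → LFormula V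
  _&_ : LFormula V → LFormula V → LFormula V
  _⊕_ : LFormula V → LFormula V → LFormula V
  _⊸_ : LFormula V → LFormula V → LFormula V
  _ᗮ  : LFormula V → LFormula V
  !_  : LFormula V → LFormula V
  ¿_  : LFormula V → LFormula V   -- the exponential "?"

-- Two-sided sequent calculus for (propositional, classical) linear logic.
-- Multisets are modelled as lists together with an exchange rule.
infix 2 _⊢LL_

data _⊢LL_ {V : Set} : List (LFormula V) → List (LFormula V) → Set where
  id   : ∀ {A} → (A ∷ []) ⊢LL (A ∷ [])
  cut  : ∀ {Γ Γ' Δ Δ' A} → Γ ⊢LL A ∷ Δ → A ∷ Γ' ⊢LL Δ' → Γ ++ Γ' ⊢LL Δ ++ Δ'
  exch : ∀ {Γ Γ' Δ Δ'} → Γ ↭ Γ' → Δ ↭ Δ' → Γ ⊢LL Δ → Γ' ⊢LL Δ'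
  𝟏L   : ∀ {Γ Δ} → Γ ⊢LL Δ → 𝟏 ∷ Γ ⊢LL Δ
  𝟏R   : [] ⊢LL 𝟏 ∷ []
  ⊥L   : ⊥ₗ ∷ [] ⊢LL []
  ⊥R   : ∀ {Γ Δ} → Γ ⊢LL Δ → Γ ⊢LL ⊥ₗ ∷ Δ
  ⊤R   : ∀ {Γ Δ} → Γ ⊢LL ⊤ₗ ∷ Δ
  𝟎L   : ∀ {Γ Δ} → 𝟎 ∷ Γ ⊢LL Δ
  ⊗L   : ∀ {Γ Δ A B} → A ∷ B ∷ Γ ⊢LL Δ → A ⊗ B ∷ Γ ⊢LL Δ
  ⊗R   : ∀ {Γ Γ' Δ Δ' A B} → Γ ⊢LL A ∷ Δ → Γ' ⊢LL B ∷ Δ' →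
         Γ ++ Γ' ⊢LL A ⊗ B ∷ Δ ++ Δ'
  ⅋L   : ∀ {Γ Γ' Δ Δ' A B} → A ∷ Γ ⊢LL Δ → B ∷ Γ' ⊢LL Δ' →
         A ⅋ B ∷ Γ ++ Γ' ⊢LL Δ ++ Δ'
  ⅋R   : ∀ {Γ Δ A B} → Γ ⊢LL A ∷ B ∷ Δ → Γ ⊢LL A ⅋ B ∷ Δ
  &L₁  : ∀ {Γ Δ A B} → A ∷ Γ ⊢LL Δ → A & B ∷ Γ ⊢LL Δ
  &L₂  : ∀ {Γ Δ A B} → B ∷ Γ ⊢LL Δ → A & B ∷ Γ ⊢LL Δ
  &R   : ∀ {Γ Δ A B} → Γ ⊢LL A ∷ Δ → Γ ⊢LL B ∷ Δ → Γ ⊢LL A & B ∷ Δ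
  ⊕L   : ∀ {Γ Δ A B} → A ∷ Γ ⊢LL Δ → B ∷ Γ ⊢LL Δ → A ⊕ B ∷ Γ ⊢LL Δ
  ⊕R₁  : ∀ {Γ Δ A B} → Γ ⊢LL A ∷ Δ → Γ ⊢LL A ⊕ B ∷ Δ
  ⊕R₂  : ∀ {Γ Δ A B} → Γ ⊢LL B ∷ Δ → Γ ⊢LL A ⊕ B ∷ Δ
  ⊸L   : ∀ {Γ Γ' Δ Δ' A B} → Γ ⊢LL A ∷ Δ → B ∷ Γ' ⊢LL Δ' →
         A ⊸ B ∷ Γ ++ Γ' ⊢LL Δ ++ Δ'
  ⊸R   : ∀ {Γ Δ A B} → A ∷ Γ ⊢LL B ∷ Δ → Γ ⊢LL A ⊸ B ∷ Δ
  negL : ∀ {Γ Δ A} → Γ ⊢LL A ∷ Δ → A ᗮ ∷ Γ ⊢LL Δ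
  negR : ∀ {Γ Δ A} → A ∷ Γ ⊢LL Δ → Γ ⊢LL A ᗮ ∷ Δ
  !W   : ∀ {Γ Δ A} → Γ ⊢LL Δ → ! A ∷ Γ ⊢LL Δ
  !C   : ∀ {Γ Δ A} → ! A ∷ ! A ∷ Γ ⊢LL Δ → ! A ∷ Γ ⊢LL Δ
  !D   : ∀ {Γ Δ A} → A ∷ Γ ⊢LL Δ → ! A ∷ Γ ⊢LL Δ
  !P   : ∀ {Γ Δ A} → map !_ Γ ⊢LL A ∷ map ¿_ Δ → map !_ Γ ⊢LL ! A ∷ map ¿_ Δ
  ?W   : ∀ {Γ Δ A} → Γ ⊢LL Δ → Γ ⊢LL ¿ A ∷ Δ
  ?C   : ∀ {Γ Δ A} → Γ ⊢LL ¿ A ∷ ¿ A ∷ Δ → Γ ⊢LL ¿ A ∷ Δ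
  ?D   : ∀ {Γ Δ A} → Γ ⊢LL A ∷ Δ → Γ ⊢LL ¿ A ∷ Δ
  ?P   : ∀ {Γ Δ A} → A ∷ map !_ Γ ⊢LL map ¿_ Δ → ¿ A ∷ map !_ Γ ⊢LL map ¿_ Δ

module _ {V : Set} (P : Formula V → Bool) where

  InP : Formula V → Set
  InP A = P A ≡ true

  NotInP : Formula V → Set
  NotInP A = P A ≡ false

  mutual
    t : Formula V → LFormula V
    t zeroᶠ    = 𝟎
    t botᶠ     = 𝟎
    t (var X)  = ! atom X
    t (A ∧ᶠ B) = (! b A) ⊗ (! b B)
    t (A ∨ᶠ B) = (! b A) ⊕ (! b B)
    t (A ⇒ᶠ B) = ! (t A ⊸ b B)

    b : Formula V → LFormula V
    b A = if P A then ¿ t A else t A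

  -- The system ML_𝒫 :  ML Γ Δ Π  means  Γ ⊢ Δ ; Π  is derivable.
  -- Stoup Π is a Maybe. Every derivable sequent is automatically a
  -- 𝒫-sequent (body ⊆ 𝒫), the side conditions below ensure this.
  data ML : List (Formula V) → List (Formula V) → Maybe (Formula V) → Set where
    exch : ∀ {Γ Γ' Δ Δ' Π} → Γ ↭ Γ' → Δ ↭ Δ' → ML Γ Δ Π → ML Γ' Δ' Π
    ax   : ∀ {A} → ML (A ∷ []) [] (just A)
    cut₁ : ∀ {Γ Γ' Δ Δ' A Π} → ML Γ Δ (just A) → ML (A ∷ Γ') Δ' Π →
           ML (Γ ++ Γ') (Δ ++ Δ') Π
    cut₂ : ∀ {Γ Γ' Δ Δ' A Π} → ML Γ (A ∷ Δ) Π → ML (A ∷ Γ') Δ' nothing →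
           ML (Γ ++ Γ') (Δ ++ Δ') Π
    der  : ∀ {Γ Δ A} → InP A → ML Γ Δ (just A) → ML Γ (A ∷ Δ) nothing
    cₗ   : ∀ {Γ Δ A Π} → ML (A ∷ A ∷ Γ) Δ Π → ML (A ∷ Γ) Δ Π
    cᵣ   : ∀ {Γ Δ A Π} → ML Γ (A ∷ A ∷ Δ) Π → ML Γ (A ∷ Δ) Π
    wₗ   : ∀ {Γ Δ A Π} → ML Γ Δ Π → ML (A ∷ Γ) Δ Π
    wᵣ   : ∀ {Γ Δ A Π} → InP A → ML Γ Δ Π → ML Γ (A ∷ Δ) Π
    zeroL : ∀ {Γ Δ Π} → All InP Δ → ML (zeroᶠ ∷ Γ) Δ Π
    botL : ML (botᶠ ∷ []) [] nothing
    ∧ₗ¹  : ∀ {Γ Δ A B C} → NotInP A → NotInP B →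
           ML (A ∷ B ∷ Γ) Δ (just C) → ML (A ∧ᶠ B ∷ Γ) Δ (just C)
    ∧ₗ²  : ∀ {Γ Δ A B} → ML (A ∷ B ∷ Γ) Δ nothing → ML (A ∧ᶠ B ∷ Γ) Δ nothing
    ∧ᵣ¹  : ∀ {Γ Γ' Δ Δ' A B} → ML Γ Δ (just A) → ML Γ' Δ' (just B) →
           ML (Γ ++ Γ') (Δ ++ Δ') (just (A ∧ᶠ B))
    ∧ᵣ²  : ∀ {Γ Γ' Δ Δ' A B} → ML Γ (A ∷ Δ) nothing → ML Γ' (B ∷ Δ') nothing →
           ML (Γ ++ Γ') (Δ ++ Δ') (just (A ∧ᶠ B))
    ∧ᵣ³  : ∀ {Γ Γ' Δ Δ' A B} → ML Γ Δ (just A) → ML Γ' (B ∷ Δ') nothing →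
           ML (Γ ++ Γ') (Δ ++ Δ') (just (A ∧ᶠ B))
    ∧ᵣ⁴  : ∀ {Γ Γ' Δ Δ' A B} → ML Γ (A ∷ Δ) nothing → ML Γ' Δ' (just B) →
           ML (Γ ++ Γ') (Δ ++ Δ') (just (A ∧ᶠ B))
    ∨ₗ¹  : ∀ {Γ Δ A B C} → NotInP A → NotInP B →
           ML (A ∷ Γ) Δ (just C) → ML (B ∷ Γ) Δ (just C) →
           ML (A ∨ᶠ B ∷ Γ) Δ (just C)
    ∨ₗ²  : ∀ {Γ Δ A B} → ML (A ∷ Γ) Δ nothing → ML (B ∷ Γ) Δ nothing →
           ML (A ∨ᶠ B ∷ Γ) Δ nothing
    ∨ᵣ¹  : ∀ {Γ Δ A B} → ML Γ Δ (just A) → ML Γ Δ (just (A ∨ᶠ B))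
    ∨ᵣ²  : ∀ {Γ Δ A B} → ML Γ Δ (just B) → ML Γ Δ (just (A ∨ᶠ B))
    ∨ᵣ³  : ∀ {Γ Δ A B} → ML Γ (A ∷ Δ) nothing → ML Γ Δ (just (A ∨ᶠ B))
    ∨ᵣ⁴  : ∀ {Γ Δ A B} → ML Γ (B ∷ Δ) nothing → ML Γ Δ (just (A ∨ᶠ B))
    ⇒ₗ¹  : ∀ {Γ Γ' Δ Δ' A B C} → NotInP B →
           ML (B ∷ Γ) Δ (just C) → ML Γ' Δ' (just A) →
           ML (A ⇒ᶠ B ∷ Γ ++ Γ') (Δ ++ Δ') (just C)
    ⇒ₗ²  : ∀ {Γ Γ' Δ Δ' A B} →
           ML (B ∷ Γ) Δ nothing → ML Γ' Δ' (just A) →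
           ML (A ⇒ᶠ B ∷ Γ ++ Γ') (Δ ++ Δ') nothing
    ⇒ₗ³  : ∀ {Γ Γ' Δ Δ' A B Π} →
           ML (B ∷ Γ) Δ nothing → ML Γ' (A ∷ Δ') Π →
           ML (A ⇒ᶠ B ∷ Γ ++ Γ') (Δ ++ Δ') Π
    ⇒ᵣ¹  : ∀ {Γ Δ A B} → ML (A ∷ Γ) Δ (just B) → ML Γ Δ (just (A ⇒ᶠ B))
    ⇒ᵣ²  : ∀ {Γ Δ A B} → ML (A ∷ Γ) (B ∷ Δ) nothing → ML Γ Δ (just (A ⇒ᶠ B))

  tStoup : Maybe (Formula V) → List (LFormula V)
  tStoup nothing  = []
  tStoup (just A) = t A ∷ []

-- Every translated formula t A is interchangeable with ! t A, so a context of
-- translated formulas behaves like a context of !-formulas: it can be contracted,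
-- weakened and promoted.  The body Δ is translated into ?-formulas, so the
-- promotion rules !P and ?P apply whenever the stoup is empty.  Each rule of ML𝒫 is
-- then simulated by its linear counterpart up to dereliction and promotion; the
-- side conditions A ∉ 𝒫 are exactly what makes b A = t A where no ?-promotion
-- is available, and a formula moved out of the body is in 𝒫, so b A = ? t A.
module Submission where

open import Defs
open import Data.Bool using (Bool; true; false; if_then_else_)
open import Data.List using (List; []; _∷_; map; _++_)
open import Data.List.Properties using (map-++; map-∘)
import Data.List.Properties as List
open import Data.List.Relation.Unary.All using (All; []; _∷_; head; tail; universal)
import Data.List.Relation.Unary.All.Properties as All
open import Data.List.Relation.Binary.Permutation.Propositional
  using (_↭_; ↭-refl; ↭-sym; ↭-trans; ↭-reflexive; prep; swap)
open import Data.List.Relation.Binary.Permutation.Propositional.Properties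
  using (shift; shifts; ∷↭∷ʳ; ++⁺ˡ; ++-comm; ++-assoc; map⁺; All-resp-↭)
open import Data.Maybe using (Maybe; just; nothing)
open import Relation.Binary.PropositionalEquality
  using (_≡_; refl; sym; cong; subst; subst₂)

module _ {V : Set} where

  private variable
    X Y : LFormula V
    Γ Γ' Δ Δ' Θ Ψ Ξ : List (LFormula V)

  exch-swapˡ : X ∷ Y ∷ Γ ⊢LL Δ → Y ∷ X ∷ Γ ⊢LL Δ
  exch-swapˡ = exch (swap _ _ ↭-refl) ↭-refl

  cutAt : ∀ Θ₀ → X ∷ [] ⊢LL Y ∷ [] → Θ₀ ++ Y ∷ Ψ ⊢LL Δ → Θ₀ ++ X ∷ Ψ ⊢LL Δ
  cutAt {X = X} {Y = Y} {Ψ = Ψ} Θ₀ d e =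
    exch (↭-sym (shift X Θ₀ Ψ)) ↭-refl (cut d (exch (shift Y Θ₀ Ψ) ↭-refl e))

  afterPrefixʳ : ∀ R → (∀ {Ξ} → Γ ⊢LL Δ ++ Ξ → Γ ⊢LL Δ' ++ Ξ) →
                 Γ ⊢LL R ++ Δ → Γ ⊢LL R ++ Δ'
  afterPrefixʳ {Δ = Δ} {Δ' = Δ'} R rule d =
    exch ↭-refl (++-comm Δ' R) (rule (exch ↭-refl (++-comm R Δ) d))

  -- Equivalent to  X ⊣⊢ ! X,  since  ! X ⊢ X  always holds.
  BangLike : LFormula V → Set
  BangLike X = X ∷ [] ⊢LL ! X ∷ []

  bang-suffix : ∀ Θ₀ → All BangLike Θ → Θ₀ ++ Θ ⊢LL Δ → Θ₀ ++ map !_ Θ ⊢LL Δ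
  bang-suffix Θ₀ [] d = d
  bang-suffix {Θ = X ∷ Θ} Θ₀ (_ ∷ bs) d =
    subst₂ _⊢LL_ (List.++-assoc Θ₀ (! X ∷ []) (map !_ Θ)) refl
      (bang-suffix (Θ₀ ++ ! X ∷ []) bs
        (subst₂ _⊢LL_ (sym (List.++-assoc Θ₀ (! X ∷ []) Θ)) refl (cutAt Θ₀ (!D id) d)))

  unbang-suffix : ∀ Θ₀ → All BangLike Θ → Θ₀ ++ map !_ Θ ⊢LL Δ → Θ₀ ++ Θ ⊢LL Δ
  unbang-suffix Θ₀ [] d = d
  unbang-suffix {Θ = X ∷ Θ} Θ₀ (x ∷ bs) d =
    subst₂ _⊢LL_ (List.++-assoc Θ₀ (X ∷ []) Θ) refl
      (unbang-suffix (Θ₀ ++ X ∷ []) bs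
        (subst₂ _⊢LL_ (sym (List.++-assoc Θ₀ (X ∷ []) (map !_ Θ))) refl (cutAt Θ₀ x d)))

  !-promote : All BangLike Θ → Θ ⊢LL X ∷ map ¿_ Ξ → Θ ⊢LL ! X ∷ map ¿_ Ξ
  !-promote bs d = unbang-suffix [] bs (!P (bang-suffix [] bs d))

  ¿-promote : All BangLike Θ → X ∷ Θ ⊢LL map ¿_ Ξ → ¿ X ∷ Θ ⊢LL map ¿_ Ξ
  ¿-promote {X = X} bs d = unbang-suffix (¿ X ∷ []) bs (?P (bang-suffix (X ∷ []) bs d))

  BangLike-contract : BangLike X → X ∷ X ∷ Γ ⊢LL Δ → X ∷ Γ ⊢LL Δ
  BangLike-contract {X} x d = cut x (!C (cutAt (! X ∷ []) (!D id) (!D d)))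

  BangLike-weaken : BangLike X → Γ ⊢LL Δ → X ∷ Γ ⊢LL Δ
  BangLike-weaken x d = cut x (!W d)

  !-BangLike : ∀ X → BangLike (! X)
  !-BangLike X = !P {Γ = X ∷ []} {Δ = []} id

  𝟎-BangLike : BangLike 𝟎
  𝟎-BangLike = 𝟎L

  ⊗-BangLike : BangLike X → BangLike Y → BangLike (X ⊗ Y)
  ⊗-BangLike x y = ⊗L (!-promote {Ξ = []} (x ∷ y ∷ []) (⊗R id id))

  ⊕-BangLike : BangLike X → BangLike Y → BangLike (X ⊕ Y)
  ⊕-BangLike x y =
    ⊕L (!-promote {Ξ = []} (x ∷ []) (⊕R₁ id)) (!-promote {Ξ = []} (y ∷ []) (⊕R₂ id))

  ¿⊸L : Γ ⊢LL ¿ X ∷ Δ → ¿ Y ∷ Γ' ⊢LL Δ' → ! (X ⊸ Y) ∷ Γ ++ Γ' ⊢LL Δ ++ Δ'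
  ¿⊸L {Γ} {X} {Δ} {Y} {Γ'} d e =
    exch (↭-trans (++-assoc Γ (F ∷ []) Γ') (shift F Γ Γ')) ↭-refl
      (cut (exch ↭-refl (↭-sym (∷↭∷ʳ (¿ Y) Δ)) (cut d ¿-map)) e)
    where
    F = ! (X ⊸ Y)
    ¿-map : ¿ X ∷ F ∷ [] ⊢LL ¿ Y ∷ []
    ¿-map = ?P {Γ = X ⊸ Y ∷ []} {Δ = Y ∷ []} (exch-swapˡ (!D (⊸L id (?D id))))

module Translation {V : Set} (P : Formula V → Bool) where

  private variable
    A : Formula V
    Γ Δ : List (Formula V)
    Π : Maybe (Formula V)
    Θ Ξ R : List (LFormula V)

  ¿t : List (Formula V) → List (LFormula V)
  ¿t Δ = map ¿_ (map (t P) Δ)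

  -- The stoup is placed before the body so that LL rules, which act on the head
  -- of a side, apply to it directly.
  infix 2 _⊢ᵗ_⨾_

  _⊢ᵗ_⨾_ : List (Formula V) → List (Formula V) → Maybe (Formula V) → Set
  Γ ⊢ᵗ Δ ⨾ Π = map (t P) Γ ⊢LL tStoup P Π ++ ¿t Δ

  t-BangLike : ∀ A → BangLike (t P A)
  t-BangLike zeroᶠ    = 𝟎-BangLike
  t-BangLike botᶠ     = 𝟎-BangLike
  t-BangLike (var X)  = !-BangLike _
  t-BangLike (A ∧ᶠ B) = ⊗-BangLike (!-BangLike _) (!-BangLike _)
  t-BangLike (A ∨ᶠ B) = ⊕-BangLike (!-BangLike _) (!-BangLike _)
  t-BangLike (A ⇒ᶠ B) = !-BangLike _

  map-t-BangLike : ∀ Γ → All BangLike (map (t P) Γ)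
  map-t-BangLike Γ = All.map⁺ (universal t-BangLike Γ)

  b-∈𝒫 : InP P A → b P A ≡ ¿ t P A
  b-∈𝒫 {A} = cong (λ p → if p then ¿ t P A else t P A)

  b-∉𝒫 : NotInP P A → b P A ≡ t P A
  b-∉𝒫 {A} = cong (λ p → if p then ¿ t P A else t P A)

  b-intro : Θ ⊢LL t P A ∷ R → Θ ⊢LL b P A ∷ R
  b-intro {A = A} d with P A
  ... | true  = ?D d
  ... | false = d

  b-intro-∈𝒫 : InP P A → Θ ⊢LL ¿ t P A ∷ R → Θ ⊢LL b P A ∷ R
  b-intro-∈𝒫 {Θ = Θ} {R = R} i = subst (λ X → Θ ⊢LL X ∷ R) (sym (b-∈𝒫 i))

  b-elim : All BangLike Θ → t P A ∷ Θ ⊢LL map ¿_ Ξ → b P A ∷ Θ ⊢LL map ¿_ Ξ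
  b-elim {A = A} bs d with P A
  ... | true  = ¿-promote bs d
  ... | false = d

  b-elim-∉𝒫 : NotInP P A → t P A ∷ Θ ⊢LL R → b P A ∷ Θ ⊢LL R
  b-elim-∉𝒫 {Θ = Θ} {R = R} n = subst (λ X → X ∷ Θ ⊢LL R) (sym (b-∉𝒫 n))

  !b-intro : ∀ Γ → Γ ⊢ᵗ Δ ⨾ just A → map (t P) Γ ⊢LL ! b P A ∷ ¿t Δ
  !b-intro Γ d = !-promote (map-t-BangLike Γ) (b-intro d)

  !b-intro-∈𝒫 : ∀ Γ → InP P A → Γ ⊢ᵗ A ∷ Δ ⨾ nothing → map (t P) Γ ⊢LL ! b P A ∷ ¿t Δ
  !b-intro-∈𝒫 Γ i d = !-promote (map-t-BangLike Γ) (b-intro-∈𝒫 i d)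

  ¿t-++ : ∀ Δ Δ' → ¿t (Δ ++ Δ') ≡ ¿t Δ ++ ¿t Δ'
  ¿t-++ Δ Δ' rewrite map-++ (t P) Δ Δ' = map-++ ¿_ (map (t P) Δ) (map (t P) Δ')

  merge : ∀ Γ Γ' Δ Δ' L R {Θ Ξ} →
          Θ ↭ L ++ map (t P) Γ ++ map (t P) Γ' → Ξ ↭ R ++ ¿t Δ ++ ¿t Δ' →
          Θ ⊢LL Ξ → L ++ map (t P) (Γ ++ Γ') ⊢LL R ++ ¿t (Δ ++ Δ')
  merge Γ Γ' Δ Δ' L R p q =
    exch (↭-trans p (↭-reflexive (cong (L ++_) (sym (map-++ (t P) Γ Γ')))))
         (↭-trans q (↭-reflexive (cong (R ++_) (sym (¿t-++ Δ Δ')))))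

  body-in-𝒫 : ML P Γ Δ Π → All (InP P) Δ
  body-in-𝒫 (exch _ q d)  = All-resp-↭ q (body-in-𝒫 d)
  body-in-𝒫 ax            = []
  body-in-𝒫 (cut₁ d e)    = All.++⁺ (body-in-𝒫 d) (body-in-𝒫 e)
  body-in-𝒫 (cut₂ d e)    = All.++⁺ (tail (body-in-𝒫 d)) (body-in-𝒫 e)
  body-in-𝒫 (der i d)     = i ∷ body-in-𝒫 d
  body-in-𝒫 (cₗ d)        = body-in-𝒫 d
  body-in-𝒫 (cᵣ d)        = tail (body-in-𝒫 d)
  body-in-𝒫 (wₗ d)        = body-in-𝒫 d
  body-in-𝒫 (wᵣ i d)      = i ∷ body-in-𝒫 d
  body-in-𝒫 (zeroL is)    = is
  body-in-𝒫 botL          = []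
  body-in-𝒫 (∧ₗ¹ _ _ d)   = body-in-𝒫 d
  body-in-𝒫 (∧ₗ² d)       = body-in-𝒫 d
  body-in-𝒫 (∧ᵣ¹ d e)     = All.++⁺ (body-in-𝒫 d) (body-in-𝒫 e)
  body-in-𝒫 (∧ᵣ² d e)     = All.++⁺ (tail (body-in-𝒫 d)) (tail (body-in-𝒫 e))
  body-in-𝒫 (∧ᵣ³ d e)     = All.++⁺ (body-in-𝒫 d) (tail (body-in-𝒫 e))
  body-in-𝒫 (∧ᵣ⁴ d e)     = All.++⁺ (tail (body-in-𝒫 d)) (body-in-𝒫 e)
  body-in-𝒫 (∨ₗ¹ _ _ d _) = body-in-𝒫 d
  body-in-𝒫 (∨ₗ² d _)     = body-in-𝒫 d
  body-in-𝒫 (∨ᵣ¹ d)       = body-in-𝒫 d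
  body-in-𝒫 (∨ᵣ² d)       = body-in-𝒫 d
  body-in-𝒫 (∨ᵣ³ d)       = tail (body-in-𝒫 d)
  body-in-𝒫 (∨ᵣ⁴ d)       = tail (body-in-𝒫 d)
  body-in-𝒫 (⇒ₗ¹ _ d e)   = All.++⁺ (body-in-𝒫 d) (body-in-𝒫 e)
  body-in-𝒫 (⇒ₗ² d e)     = All.++⁺ (body-in-𝒫 d) (body-in-𝒫 e)
  body-in-𝒫 (⇒ₗ³ d e)     = All.++⁺ (body-in-𝒫 d) (tail (body-in-𝒫 e))
  body-in-𝒫 (⇒ᵣ¹ d)       = body-in-𝒫 d
  body-in-𝒫 (⇒ᵣ² d)       = tail (body-in-𝒫 d)

  translate : ML P Γ Δ Π → Γ ⊢ᵗ Δ ⨾ Π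
  translate {Π = Π} (exch p q d) =
    exch (map⁺ (t P) p) (++⁺ˡ (tStoup P Π) (map⁺ ¿_ (map⁺ (t P) q))) (translate d)
  translate ax = id
  translate (cut₁ {Γ} {Γ'} {Δ} {Δ'} {Π = Π} d e) =
    merge Γ Γ' Δ Δ' [] (tStoup P Π) ↭-refl (shifts (¿t Δ) (tStoup P Π)) (cut (translate d) (translate e))
  translate (cut₂ {Γ} {Γ'} {Δ} {Δ'} {Π = Π} d e) =
    merge Γ Γ' Δ Δ' [] (tStoup P Π) ↭-refl (++-assoc (tStoup P Π) (¿t Δ) (¿t Δ'))
      (cut (exch ↭-refl (shift _ (tStoup P Π) (¿t Δ)) (translate d))
           (¿-promote (map-t-BangLike Γ') (translate e)))
  translate (der _ d) = ?D (translate d)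
  translate (cₗ {A = A} d) = BangLike-contract (t-BangLike A) (translate d)
  translate (cᵣ {Π = Π} d) = afterPrefixʳ (tStoup P Π) ?C (translate d)
  translate (wₗ {A = A} d) = BangLike-weaken (t-BangLike A) (translate d)
  translate (wᵣ {Π = Π} _ d) = afterPrefixʳ (tStoup P Π) ?W (translate d)
  translate (zeroL _) = 𝟎L
  translate botL = 𝟎L
  translate (∧ₗ¹ nA nB d) =
    ⊗L (!D (b-elim-∉𝒫 nA (exch-swapˡ (!D (b-elim-∉𝒫 nB (exch-swapˡ (translate d)))))))
  translate (∧ₗ² {Γ} {A = A} d) =
    ⊗L (!D (b-elim (!-BangLike _ ∷ map-t-BangLike Γ)
      (exch-swapˡ (!D (b-elim (t-BangLike A ∷ map-t-BangLike Γ) (exch-swapˡ (translate d)))))))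
  translate (∧ᵣ¹ {Γ} {Γ'} {Δ} {Δ'} d e) =
    merge Γ Γ' Δ Δ' [] (_ ∷ []) ↭-refl ↭-refl (⊗R (!b-intro Γ (translate d)) (!b-intro Γ' (translate e)))
  translate (∧ᵣ² {Γ} {Γ'} {Δ} {Δ'} d e) =
    merge Γ Γ' Δ Δ' [] (_ ∷ []) ↭-refl ↭-refl
      (⊗R (!b-intro-∈𝒫 Γ (head (body-in-𝒫 d)) (translate d))
          (!b-intro-∈𝒫 Γ' (head (body-in-𝒫 e)) (translate e)))
  translate (∧ᵣ³ {Γ} {Γ'} {Δ} {Δ'} d e) =
    merge Γ Γ' Δ Δ' [] (_ ∷ []) ↭-refl ↭-refl
      (⊗R (!b-intro Γ (translate d)) (!b-intro-∈𝒫 Γ' (head (body-in-𝒫 e)) (translate e)))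
  translate (∧ᵣ⁴ {Γ} {Γ'} {Δ} {Δ'} d e) =
    merge Γ Γ' Δ Δ' [] (_ ∷ []) ↭-refl ↭-refl
      (⊗R (!b-intro-∈𝒫 Γ (head (body-in-𝒫 d)) (translate d)) (!b-intro Γ' (translate e)))
  translate (∨ₗ¹ nA nB d e) =
    ⊕L (!D (b-elim-∉𝒫 nA (translate d))) (!D (b-elim-∉𝒫 nB (translate e)))
  translate (∨ₗ² {Γ} d e) =
    ⊕L (!D (b-elim (map-t-BangLike Γ) (translate d))) (!D (b-elim (map-t-BangLike Γ) (translate e)))
  translate (∨ᵣ¹ {Γ} d) = ⊕R₁ (!b-intro Γ (translate d))
  translate (∨ᵣ² {Γ} d) = ⊕R₂ (!b-intro Γ (translate d))
  translate (∨ᵣ³ {Γ} d) = ⊕R₁ (!b-intro-∈𝒫 Γ (head (body-in-𝒫 d)) (translate d))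
  translate (∨ᵣ⁴ {Γ} d) = ⊕R₂ (!b-intro-∈𝒫 Γ (head (body-in-𝒫 d)) (translate d))
  translate (⇒ₗ¹ {Γ} {Γ'} {Δ} {Δ'} {C = C} nB d e) =
    merge Γ Γ' Δ Δ' (_ ∷ []) (t P C ∷ []) (prep _ (++-comm (map (t P) Γ') (map (t P) Γ)))
      (++-comm (¿t Δ') (t P C ∷ ¿t Δ))
      (!D (⊸L (translate e) (b-elim-∉𝒫 nB (translate d))))
  translate (⇒ₗ² {Γ} {Γ'} {Δ} {Δ'} d e) =
    merge Γ Γ' Δ Δ' (_ ∷ []) [] (prep _ (++-comm (map (t P) Γ') (map (t P) Γ))) (++-comm (¿t Δ') (¿t Δ))
      (!D (⊸L (translate e) (b-elim (map-t-BangLike Γ) (translate d))))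
  translate (⇒ₗ³ {Γ} {Γ'} {Δ} {Δ'} {Π = Π} d e) =
    merge Γ Γ' Δ Δ' (_ ∷ []) (tStoup P Π) (prep _ (++-comm (map (t P) Γ') (map (t P) Γ)))
      (↭-trans (++-assoc (tStoup P Π) (¿t Δ') (¿t Δ)) (++⁺ˡ (tStoup P Π) (++-comm (¿t Δ') (¿t Δ))))
      (¿⊸L (exch ↭-refl (shift _ (tStoup P Π) (¿t Δ')) (translate e))
           (¿-promote (map-t-BangLike Γ) (b-elim (map-t-BangLike Γ) (translate d))))
  translate (⇒ᵣ¹ {Γ} d) = !-promote (map-t-BangLike Γ) (⊸R (b-intro (translate d)))
  translate (⇒ᵣ² {Γ} d) =
    !-promote (map-t-BangLike Γ) (⊸R (b-intro-∈𝒫 (head (body-in-𝒫 d)) (translate d)))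

theorem5p3 : {V : Set} (P : Formula V → Bool)
    (Γ Δ : List (Formula V)) (Π : Maybe (Formula V)) →
    ML P Γ Δ Π →
    map (t P) Γ ⊢LL (map (λ D → ¿ t P D) Δ ++ tStoup P Π)
theorem5p3 P Γ Δ Π d =
  exch ↭-refl
    (↭-trans (++-comm (tStoup P Π) _) (↭-reflexive (cong (_++ tStoup P Π) (sym (map-∘ Δ)))))
    (Translation.translate P d)
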